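{- For every positive integer $n$, $f(n)=1$ if $d(n)=1$ and $f(n)=0$ if $d(n)\in\{0,2\}$; that is, $(f(n))_{n\ge1}$ is the image of $(d(n))_{n\ge1}$ under the letter-to-letter map $0\mapsto0$, $1\mapsto1$, $2\mapsto0$. Moreover, letting $h(n)=f(n)-f(n+1)$, the sequence $(h(n))_{n\ge1}$ is the image of $(d(n))_{n\ge1}$ under the map $0\mapsto-1$, $1\mapsto1$, $2\mapsto0$.
   Context: Fibonacci numbers: $F_0=0,F_1=1,F_n=F_{n-1}+F_{n-2}$. Zeckendorf expansion: every positive integer $n$ is uniquely $n=\sum_{j\ge0}\epsilon_jF_{j+2}$ with $\epsilon_j\in\{0,1\}$, finitely many nonzero, $\epsilon_j\epsilon_{j+1}=0$. Let $k(n)=\min\{j:\epsilon_j=1\}$ and set $d(n)=0$ if $k(n)=0$, $d(n)=1$ if $k(n)$ is odd, $d(n)=2$ if $k(n)$ is even and $\ge2$. The sequence $(f(n))_{n\ge1}$ is the infinite Fibonacci word $f(1)f(2)f(3)\dots=0100101001001\dots$, the fixed point of the morphism $0\mapsto01$, $1\mapsto0$. -}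

module Defs where

open import Data.Nat using (ℕ; zero; suc; _+_; _*_; _<_)
open import Data.Bool using (Bool; true; false)
open import Data.List using (List; []; _∷_; concatMap)
open import Data.Product using (_×_)
open import Relation.Binary.PropositionalEquality using (_≡_)

F : ℕ → ℕ
F zero = 0
F (suc zero) = 1
F (suc (suc n)) = F (suc n) + F n

-- A finite 0/1 digit string ε_0 ε_1 ... ε_{L-1} (head = ε_0); digits beyond the end are 0.
digit : List Bool → ℕ → Bool
digit [] _ = false
digit (b ∷ bs) zero = b
digit (b ∷ bs) (suc j) = digit bs j

bitVal : Bool → ℕ
bitVal true = 1
bitVal false = 0

valueFrom : ℕ → List Bool → ℕ
valueFrom j [] = 0
valueFrom j (b ∷ bs) = bitVal b * F (j + 2) + valueFrom (suc j) bs

value : List Bool → ℕ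
value = valueFrom 0

Zeckendorf : List Bool → ℕ → Set
Zeckendorf ε n = value ε ≡ n × (∀ j → digit ε j ≡ true → digit ε (suc j) ≡ false)

IsLowestOne : List Bool → ℕ → Set
IsLowestOne ε k = digit ε k ≡ true × (∀ i → i < k → digit ε i ≡ false)

isEven : ℕ → Bool
isEven zero = true
isEven (suc zero) = false
isEven (suc (suc n)) = isEven n

dOfK : ℕ → ℕ
dOfK zero = 0
dOfK (suc k) with isEven (suc k)
... | true = 2
... | false = 1

-- the morphism 0 ↦ 01, 1 ↦ 0 (letters encoded as ℕ, anything ≠ 0 treated as 1)
σ : ℕ → List ℕ
σ zero = 0 ∷ 1 ∷ []
σ (suc _) = 0 ∷ []

σ* : List ℕ → List ℕ
σ* = concatMap σ

iter : ℕ → List ℕ → List ℕ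
iter zero w = w
iter (suc m) w = iter m (σ* w)

at : List ℕ → ℕ → ℕ
at [] _ = 0
at (x ∷ xs) zero = x
at (x ∷ xs) (suc i) = at xs i

-- Fibonacci word, 1-indexed: f(n) is the n-th letter of σ^n(0), which has length F_{n+2} ≥ n,
-- and σ^m(0) is a prefix of σ^{m+1}(0), so this is the n-th letter of the fixed point.
f : ℕ → ℕ
f zero = 0
f (suc i) = at (iter (suc i) (0 ∷ [])) i

{-# OPTIONS --safe #-}
-- Write x(p) = f(p+1) for the 0-indexed Fibonacci word.  Since σ^{m+2}(0) = σ^{m+1}(0) σ^m(0)
-- and |σ^{m+1}(0)| = F_{m+3}, we have x(F_{m+3} + q) = x(q) for q < F_{m+2}.  Write
-- n = F_{k+2} + V, where V collects the Zeckendorf digits above k (all at indices ≥ k+2).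
-- Stripping the digits of V one by one with this shift identity gives x(V + q) = x(q) for
-- q < F_{k+3}, so f(n) = x(F_{k+2} - 1) and f(n+1) = x(F_{k+2}): the last letter of σ^k(0)
-- and the letter right after it.  The shift identity again shows that the former has the
-- parity of k and the latter is 1 exactly when k = 0.
module Submission where

open import Defs
open import Data.Nat using (ℕ; zero; suc; _+_; _∸_; _≤_; _<_; z≤n; s≤s; _≤′_; ≤′-refl; ≤′-step)
open import Data.Nat.Properties
open import Data.Integer using (-[1+_]) renaming (_-_ to _-ℤ_; +_ to ℤ+)
open import Data.List using (List; []; _∷_; _++_; length)
open import Data.List.Properties using (concatMap-++; length-++)
open import Data.Bool using (Bool; true; false; if_then_else_)
open import Data.Product using (_×_; _,_; Σ-syntax)
open import Data.Sum using (inj₁; inj₂)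
open import Relation.Nullary using (contradiction)
open import Relation.Binary.PropositionalEquality

F-step : ∀ n → F n ≤ F (suc n)
F-step zero = z≤n
F-step (suc n) = m≤m+n (F (suc n)) (F n)

F-mono′ : ∀ {m n} → m ≤′ n → F m ≤ F n
F-mono′ ≤′-refl = ≤-refl
F-mono′ {n = suc n} (≤′-step m≤′n) = ≤-trans (F-mono′ m≤′n) (F-step n)

F-mono : ∀ {m n} → m ≤ n → F m ≤ F n
F-mono m≤n = F-mono′ (≤⇒≤′ m≤n)

F-pos : ∀ n → 0 < F (suc n)
F-pos zero = s≤s z≤n
F-pos (suc n) = <-≤-trans (F-pos n) (F-step (suc n))

n<F[2+n] : ∀ n → n < F (suc (suc n))
n<F[2+n] zero = s≤s z≤n
n<F[2+n] (suc n) = begin-strict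
  suc n                  ≡⟨ +-comm 1 n ⟩
  n + 1                  <⟨ +-mono-<-≤ (n<F[2+n] n) (F-pos n) ⟩
  F (suc (suc n)) + F (suc n) ∎
  where open ≤-Reasoning

F[2+n]<F[3+n] : ∀ n → F (suc (suc n)) < F (suc (suc (suc n)))
F[2+n]<F[3+n] n = m<m+n (F (suc (suc n))) (F-pos n)

W : ℕ → List ℕ
W m = iter m (0 ∷ [])

iter-σ* : ∀ m w → iter m (σ* w) ≡ σ* (iter m w)
iter-σ* zero w = refl
iter-σ* (suc m) w = iter-σ* m (σ* w)

W-split : ∀ m → W (suc (suc m)) ≡ W (suc m) ++ W m
W-split zero = refl
W-split (suc m) = begin
  W (suc (suc (suc m)))          ≡⟨ iter-σ* (suc (suc m)) (0 ∷ []) ⟩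
  σ* (W (suc (suc m)))           ≡⟨ cong σ* (W-split m) ⟩
  σ* (W (suc m) ++ W m)          ≡⟨ concatMap-++ σ (W (suc m)) (W m) ⟩
  σ* (W (suc m)) ++ σ* (W m)     ≡⟨ sym (cong₂ _++_ (iter-σ* (suc m) (0 ∷ [])) (iter-σ* m (0 ∷ []))) ⟩
  W (suc (suc m)) ++ W (suc m)   ∎
  where open ≡-Reasoning

length-W : ∀ m → length (W m) ≡ F (suc (suc m))
length-W zero = refl
length-W (suc zero) = refl
length-W (suc (suc m)) = begin
  length (W (suc (suc m)))             ≡⟨ cong length (W-split m) ⟩
  length (W (suc m) ++ W m)            ≡⟨ length-++ (W (suc m)) ⟩
  length (W (suc m)) + length (W m)    ≡⟨ cong₂ _+_ (length-W (suc m)) (length-W m) ⟩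
  F (suc (suc (suc m))) + F (suc (suc m)) ∎
  where open ≡-Reasoning

at-++ˡ : ∀ xs ys {i} → i < length xs → at (xs ++ ys) i ≡ at xs i
at-++ˡ (x ∷ xs) ys {zero} _ = refl
at-++ˡ (x ∷ xs) ys {suc i} (s≤s i<len) = at-++ˡ xs ys i<len

at-++ʳ : ∀ xs ys i → at (xs ++ ys) (length xs + i) ≡ at ys i
at-++ʳ [] ys i = refl
at-++ʳ (x ∷ xs) ys i = at-++ʳ xs ys i

at-W-split : ∀ m i → at (W (suc (suc m))) (F (suc (suc (suc m))) + i) ≡ at (W m) i
at-W-split m i rewrite W-split m | sym (length-W (suc m)) = at-++ʳ (W (suc m)) (W m) i

at-W-suc : ∀ m {p} → p < F (suc (suc m)) → at (W (suc m)) p ≡ at (W m) p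
at-W-suc zero {zero} _ = refl
at-W-suc zero {suc p} (s≤s ())
at-W-suc (suc m) p<F rewrite W-split m =
  at-++ˡ (W (suc m)) (W m) (subst (_ <_) (sym (length-W (suc m))) p<F)

at-W-mono′ : ∀ {m m′ p} → m ≤′ m′ → p < F (suc (suc m)) → at (W m′) p ≡ at (W m) p
at-W-mono′ ≤′-refl _ = refl
at-W-mono′ {m′ = suc m′} (≤′-step m≤′m′) p<F =
  trans (at-W-suc m′ (<-≤-trans p<F (F-mono (s≤s (s≤s (≤′⇒≤ m≤′m′))))))
        (at-W-mono′ m≤′m′ p<F)

at-W-mono : ∀ {m m′ p} → m ≤ m′ → p < F (suc (suc m)) → at (W m′) p ≡ at (W m) p
at-W-mono m≤m′ = at-W-mono′ (≤⇒≤′ m≤m′)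

word : ℕ → ℕ
word p = f (suc p)

word≡at-W : ∀ m {p} → p < F (suc (suc m)) → word p ≡ at (W m) p
word≡at-W m {p} p<F with ≤-total m (suc p)
... | inj₁ m≤1+p = at-W-mono m≤1+p p<F
... | inj₂ 1+p≤m = sym (at-W-mono 1+p≤m (<-trans (n<F[2+n] p) (F[2+n]<F[3+n] p)))

word-shift : ∀ m {q} → q < F (suc (suc m)) → word (F (suc (suc (suc m))) + q) ≡ word q
word-shift m {q} q<F = begin
  word (F (suc (suc (suc m))) + q)          ≡⟨ word≡at-W (suc (suc m)) (+-monoʳ-< (F (suc (suc (suc m)))) q<F) ⟩
  at (W (suc (suc m))) (F (suc (suc (suc m))) + q) ≡⟨ at-W-split m q ⟩
  at (W m) q                                ≡⟨ word≡at-W m q<F ⟨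
  word q                                    ∎
  where open ≡-Reasoning

lastLetter : ℕ → ℕ
lastLetter k = if isEven k then 0 else 1

nextLetter : ℕ → ℕ
nextLetter zero = 1
nextLetter (suc _) = 0

word-F∸1 : ∀ k → word (F (suc (suc k)) ∸ 1) ≡ lastLetter k
word-F∸1 zero = refl
word-F∸1 (suc zero) = refl
word-F∸1 (suc (suc k)) = begin
  word (F (suc (suc (suc (suc k)))) ∸ 1)            ≡⟨ cong word (+-∸-assoc (F (suc (suc (suc k)))) (F-pos (suc k))) ⟩
  word (F (suc (suc (suc k))) + (F (suc (suc k)) ∸ 1)) ≡⟨ word-shift k (∸-monoˡ-< (n<1+n _) (F-pos (suc k))) ⟩
  word (F (suc (suc k)) ∸ 1)                        ≡⟨ word-F∸1 k ⟩
  lastLetter k                                      ∎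
  where open ≡-Reasoning

word-F : ∀ k → word (F (suc (suc k))) ≡ nextLetter k
word-F zero = refl
word-F (suc k) = trans (cong word (sym (+-identityʳ (F (suc (suc (suc k))))))) (word-shift k (F-pos (suc k)))

NonAdjacent : List Bool → Set
NonAdjacent ε = ∀ j → digit ε j ≡ true → digit ε (suc j) ≡ false

valueFrom-true : ∀ j ds → valueFrom j (true ∷ ds) ≡ F (suc (suc j)) + valueFrom (suc j) ds
valueFrom-true j ds = cong (_+ valueFrom (suc j) ds) (trans (*-identityˡ _) (cong F (+-comm j 2)))

word-valueFrom-+ : ∀ cs s {q} → NonAdjacent cs → q < F (suc (suc s))
  → word (valueFrom (suc s) cs + q) ≡ word q
word-valueFrom-+ [] s _ _ = refl
word-valueFrom-+ (false ∷ ds) s na q<F =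
  word-valueFrom-+ ds (suc s) (λ j → na (suc j)) (<-≤-trans q<F (F-step (suc (suc s))))
word-valueFrom-+ (true ∷ true ∷ _) s na _ = contradiction (na 0 refl) λ ()
word-valueFrom-+ (true ∷ []) s {q} _ q<F
  rewrite valueFrom-true (suc s) [] | +-identityʳ (F (suc (suc (suc s)))) = word-shift s q<F
word-valueFrom-+ (true ∷ false ∷ es) s {q} na q<F rewrite valueFrom-true (suc s) (false ∷ es) = begin
  word (T + V + q)   ≡⟨ cong word (trans (cong (_+ q) (+-comm T V)) (+-assoc V T q)) ⟩
  word (V + (T + q)) ≡⟨ word-valueFrom-+ es (suc (suc s)) (λ j → na (suc (suc j))) (+-monoʳ-< T q<F) ⟩
  word (T + q)       ≡⟨ word-shift s q<F ⟩
  word q             ∎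
  where
  open ≡-Reasoning
  T = F (suc (suc (suc s)))
  V = valueFrom (suc (suc (suc s))) es

valueFrom-lowest : ∀ ε j k → NonAdjacent ε → IsLowestOne ε k
  → Σ[ es ∈ List Bool ] NonAdjacent es
      × valueFrom j ε ≡ F (suc (suc (j + k))) + valueFrom (suc (suc (j + k))) es
valueFrom-lowest [] j k _ (() , _)
valueFrom-lowest (false ∷ bs) j zero _ (() , _)
valueFrom-lowest (false ∷ bs) j (suc k) na (dk , below)
  rewrite +-suc j k = valueFrom-lowest bs (suc j) k (λ i → na (suc i)) (dk , λ i i<k → below (suc i) (s≤s i<k))
valueFrom-lowest (true ∷ bs) j (suc k) _ (_ , below) = contradiction (below 0 (s≤s z≤n)) λ ()
valueFrom-lowest (true ∷ true ∷ _) j zero na _ = contradiction (na 0 refl) λ ()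
valueFrom-lowest (true ∷ []) j zero _ _
  rewrite +-identityʳ j = [] , (λ _ ()) , valueFrom-true j []
valueFrom-lowest (true ∷ false ∷ es) j zero na _
  rewrite +-identityʳ j = es , (λ i → na (suc (suc i))) , valueFrom-true j (false ∷ es)

letters-at-lowest : ∀ n ε k → Zeckendorf ε (suc n) → IsLowestOne ε k
  → f (suc n) ≡ lastLetter k × f (suc (suc n)) ≡ nextLetter k
letters-at-lowest n ε k (valueε , na) lowest with valueFrom-lowest ε 0 k na lowest
... | es , na-es , split = letter-n , letter-1+n
  where
  open ≡-Reasoning
  T = F (suc (suc k))
  V = valueFrom (suc (suc k)) es
  1+n≡T+V : suc n ≡ T + V
  1+n≡T+V = trans (sym valueε) split
  n≡V+T∸1 : n ≡ V + (T ∸ 1)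
  n≡V+T∸1 = suc-injective (begin
    suc n            ≡⟨ 1+n≡T+V ⟩
    T + V            ≡⟨ cong (_+ V) (m+[n∸m]≡n (F-pos (suc k))) ⟨
    suc (T ∸ 1 + V)  ≡⟨ cong suc (+-comm (T ∸ 1) V) ⟩
    suc (V + (T ∸ 1)) ∎)
  letter-n : word n ≡ lastLetter k
  letter-n = begin
    word n            ≡⟨ cong word n≡V+T∸1 ⟩
    word (V + (T ∸ 1)) ≡⟨ word-valueFrom-+ es (suc k) na-es (≤-<-trans (m∸n≤m T 1) (F[2+n]<F[3+n] k)) ⟩
    word (T ∸ 1)      ≡⟨ word-F∸1 k ⟩
    lastLetter k      ∎
  letter-1+n : word (suc n) ≡ nextLetter k
  letter-1+n = begin
    word (suc n)      ≡⟨ cong word (trans 1+n≡T+V (+-comm T V)) ⟩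
    word (V + T)      ≡⟨ word-valueFrom-+ es (suc k) na-es (F[2+n]<F[3+n] k) ⟩
    word T            ≡⟨ word-F k ⟩
    nextLetter k      ∎

ImagesOfD : ℕ → ℕ → ℕ → Set
ImagesOfD k a b = ((dOfK k ≡ 0 → a ≡ 0) × (dOfK k ≡ 1 → a ≡ 1) × (dOfK k ≡ 2 → a ≡ 0))
    × ((dOfK k ≡ 0 → ℤ+ a -ℤ ℤ+ b ≡ -[1+ 0 ])
    × (dOfK k ≡ 1 → ℤ+ a -ℤ ℤ+ b ≡ ℤ+ 1)
    × (dOfK k ≡ 2 → ℤ+ a -ℤ ℤ+ b ≡ ℤ+ 0))

imagesOfD-letters : ∀ k → ImagesOfD k (lastLetter k) (nextLetter k)
imagesOfD-letters zero = ((λ _ → refl) , (λ ()) , (λ ())) , ((λ _ → refl) , (λ ()) , (λ ()))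
imagesOfD-letters (suc k) with isEven (suc k)
... | true = ((λ ()) , (λ ()) , (λ _ → refl)) , ((λ ()) , (λ ()) , (λ _ → refl))
... | false = ((λ ()) , (λ _ → refl) , (λ ())) , ((λ ()) , (λ _ → refl) , (λ ()))

proposition5 : ∀ (n : ℕ) (ε : List Bool) (k : ℕ) → Zeckendorf ε (suc n) → IsLowestOne ε k
    → ((dOfK k ≡ 0 → f (suc n) ≡ 0) × (dOfK k ≡ 1 → f (suc n) ≡ 1) × (dOfK k ≡ 2 → f (suc n) ≡ 0))
    × ((dOfK k ≡ 0 → ℤ+ (f (suc n)) -ℤ ℤ+ (f (suc (suc n))) ≡ -[1+ 0 ])
    × (dOfK k ≡ 1 → ℤ+ (f (suc n)) -ℤ ℤ+ (f (suc (suc n))) ≡ ℤ+ 1)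
    × (dOfK k ≡ 2 → ℤ+ (f (suc n)) -ℤ ℤ+ (f (suc (suc n))) ≡ ℤ+ 0))
proposition5 n ε k zeckendorf lowest with letters-at-lowest n ε k zeckendorf lowest
... | letter-n , letter-1+n =
  subst₂ (ImagesOfD k) (sym letter-n) (sym letter-1+n) (imagesOfD-letters k)
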